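{- Let $r,m$ be nonnegative integers and $n$ a positive integer. There is a bijection between the set of pairs of partitions $(\alpha,\beta)$ with $|\alpha|+|\beta|=n$, $\beta_1\le\alpha_1$, exactly $r$ balanced parts and $l(\alpha)-l(\beta)=m$, and the set of strict shifted pairs of partitions $(\bar\alpha,\bar\beta)$ with $|\bar\alpha|+|\bar\beta|=n$ and $l(\bar\alpha)-l(\bar\beta)=m+2r$.
   Context: A partition is a finite nonincreasing sequence of positive integers; $l(\lambda)$ is the number of parts, $|\lambda|$ the sum, $\lambda_1$ the largest part ($0$ if empty); set $\lambda_i=0$ for $i>l(\lambda)$. For a pair of partitions $(\alpha,\beta)$, the parts of $\beta$ are classified as balanced or unbalanced recursively in order $j=1,2,\ldots$: $\beta_j$ is balanced if $\alpha_{j+1}\le\beta_j$ and the number of indices $i\ge 2$ with $\alpha_i>\beta_j$ equals the number of unbalanced parts among $\beta_1,\ldots,\beta_{j-1}$; otherwise it is unbalanced. The number of balanced parts of $(\alpha,\beta)$ is the number of balanced parts of $\beta$. A pair of partitions $(\alpha,\beta)$ is strict shifted if $l(\alpha)>l(\beta)$ and $\alpha_{i+1}>\beta_i$ for $1\le i\le l(\beta)$. -}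

module Defs where

open import Data.Bool using (Bool; true; false; T; _∧_; if_then_else_)
open import Data.Nat using (ℕ; zero; suc; _+_; _≤ᵇ_; _<ᵇ_; _≡ᵇ_)
open import Data.List using (List; []; _∷_; length; drop; upTo)
open import Data.Nat.ListAction using (sum)
open import Data.Product using (Σ; _×_; _,_; proj₁; proj₂)
open import Relation.Nullary.Decidable using (⌊_⌋)
import Data.Nat as ℕ

isPartition : List ℕ → Bool
isPartition []            = true
isPartition (x ∷ [])      = 1 ≤ᵇ x
isPartition (x ∷ y ∷ xs)  = (y ≤ᵇ x) ∧ isPartition (y ∷ xs)

len : List ℕ → ℕ
len = length

size : List ℕ → ℕ
size = sum

-- nth λ k = λ_{k+1}  (0 when k+1 > l(λ)); so λ_1 = nth λ 0.
nth : List ℕ → ℕ → ℕ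
nth []       _       = 0
nth (x ∷ _)  zero    = x
nth (_ ∷ xs) (suc k) = nth xs k

countGt : ℕ → List ℕ → ℕ
countGt b []       = 0
countGt b (x ∷ xs) = if b <ᵇ x then suc (countGt b xs) else countGt b xs

-- balAux α k u βs : α is the full first partition, k = j-1 is the (0-based)
-- index of the current part β_j, u = number of unbalanced parts among
-- β_1..β_{j-1}, βs = remaining parts β_j, β_{j+1}, ...
-- β_j is balanced iff α_{j+1} ≤ β_j and #{i ≥ 2 : α_i > β_j} = u.
balAux : List ℕ → ℕ → ℕ → List ℕ → ℕ
balAux α k u []       = 0
balAux α k u (b ∷ bs) =
  if (nth α (suc k) ≤ᵇ b) ∧ (countGt b (drop 1 α) ≡ᵇ u)
  then suc (balAux α (suc k) u bs)
  else balAux α (suc k) (suc u) bs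

balancedParts : List ℕ → List ℕ → ℕ
balancedParts α β = balAux α 0 0 β

allB : {A : Set} → (A → Bool) → List A → Bool
allB p []       = true
allB p (x ∷ xs) = p x ∧ allB p xs

isStrictShifted : List ℕ → List ℕ → Bool
isStrictShifted α β =
  (len β <ᵇ len α) ∧ allB (λ k → nth β k <ᵇ nth α (suc k)) (upTo (len β))

PairsA : ℕ → ℕ → ℕ → Set
PairsA r m n = Σ (List ℕ × List ℕ) λ { (α , β) → T (
     isPartition α ∧ isPartition β
   ∧ (size α + size β ≡ᵇ n)
   ∧ (nth β 0 ≤ᵇ nth α 0)
   ∧ (balancedParts α β ≡ᵇ r)
   ∧ (len α ≡ᵇ len β + m)) }

PairsB : ℕ → ℕ → ℕ → Set
PairsB r m n = Σ (List ℕ × List ℕ) λ { (α , β) → T (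
     isPartition α ∧ isPartition β
   ∧ isStrictShifted α β
   ∧ (size α + size β ≡ᵇ n)
   ∧ (len α ≡ᵇ len β + (m + 2 ℕ.* r))) }

module Submission where

open import Defs
open import Data.Nat using (ℕ; _≤_)
open import Function.Bundles using (_⤖_)

-- Put the first part a = α₁ aside and merge α₂, α₃, … and β into one
-- word sorted by decreasing value: parts of α become up-letters, parts of β
-- down-letters, and the word is read as a lattice path.  A part β_j is
-- balanced exactly when it is read while the credit (parts of α read minus
-- unbalanced parts of β read) is 0, and the pair is strict shifted exactly
-- when the path never goes below 0.  The map raise turns every balanced
-- down-letter into an up-letter, giving a nonnegative path; its inverse lower
-- turns back, for h = 0, …, r - 1, the last up-step leaving height h.

open import Data.Bool using (Bool; true; false; T; _∧_; if_then_else_)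
open import Data.Bool.Properties using (T-∧; T-irrelevant; ∧-zeroʳ)
open import Data.Empty using (⊥; ⊥-elim)
open import Data.List using (List; []; _∷_; map; length; _++_; [_]; drop; upTo)
open import Data.List.Properties using (++-assoc; length-++)
open import Data.List.Relation.Unary.All as All using (All; []; _∷_)
open import Data.List.Relation.Unary.All.Properties using (++⁺; applyUpTo⁺₁; applyUpTo⁻; map⁺; map⁻)
open import Data.List.Relation.Unary.AllPairs as AllPairs using (AllPairs; []; _∷_)
open import Data.List.Relation.Unary.Linked using (Linked; []; [-]; _∷_)
open import Data.List.Relation.Unary.Linked.Properties using (AllPairs⇒Linked; Linked⇒AllPairs)
open import Data.Nat using (zero; suc; pred; _+_; _*_; _<_; _≥_; z≤n; s≤s; z<s; s<s; _≤ᵇ_; _<ᵇ_; _≡ᵇ_)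
open import Data.Nat.ListAction using (sum)
open import Data.Nat.Properties
open import Algebra.Properties.CommutativeSemigroup +-commutativeSemigroup using (x∙yz≈y∙xz)
open import Data.Nat.Tactic.RingSolver using (solve-∀)
open import Data.Product using (Σ; _×_; _,_; proj₁; proj₂)
open import Data.Sum using (_⊎_; inj₁; inj₂)
open import Data.Unit using (⊤; tt)
open import Function.Base using (_∘_; id)
open import Function.Bundles using (Equivalence; mk↔ₛ′)
open import Function.Properties.Inverse using (↔⇒⤖)
open import Relation.Binary.PropositionalEquality hiding ([_])
open import Relation.Nullary using (¬_; Dec; Irrelevant; yes; no; contradiction)
open import Relation.Nullary.Decidable using (_×-dec_; dec-true; dec-false)
open import Relation.Nullary.Reflects using (ofʸ; ofⁿ)

-- A word records a pair of partitions (a ∷ xs , ys) as one list of letters: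
-- the parts of xs become up-letters, the parts of ys down-letters.
data Letter : Set where
  up   : ℕ → Letter
  down : ℕ → Letter

value : Letter → ℕ
value (up v)   = v
value (down v) = v

Word : Set
Word = List Letter

ups : Word → List ℕ
ups []            = []
ups (up v ∷ w)    = v ∷ ups w
ups (down _ ∷ w)  = ups w

downs : Word → List ℕ
downs []           = []
downs (up _ ∷ w)   = downs w
downs (down v ∷ w) = v ∷ downs w

merge : List ℕ → List ℕ → Word
merge []       ys       = map down ys
merge (x ∷ xs) []       = up x ∷ merge xs []
merge (x ∷ xs) (y ∷ ys) =
  if y <ᵇ x then up x ∷ merge xs (y ∷ ys) else down y ∷ merge (x ∷ xs) ys

merge-cases : ∀ (P : Word → Set) x xs y ys →
              (y < x → P (up x ∷ merge xs (y ∷ ys))) →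
              (x ≤ y → P (down y ∷ merge (x ∷ xs) ys)) →
              P (merge (x ∷ xs) (y ∷ ys))
merge-cases P x xs y ys ifUp ifDown with y <ᵇ x | <ᵇ-reflects-< y x
... | true  | ofʸ y<x = ifUp y<x
... | false | ofⁿ y≮x = ifDown (≮⇒≥ y≮x)

ups-merge : ∀ xs ys → ups (merge xs ys) ≡ xs
ups-merge []       []       = refl
ups-merge []       (y ∷ ys) = ups-merge [] ys
ups-merge (x ∷ xs) []       = cong (x ∷_) (ups-merge xs [])
ups-merge (x ∷ xs) (y ∷ ys) = merge-cases (λ w → ups w ≡ x ∷ xs) x xs y ys
  (λ _ → cong (x ∷_) (ups-merge xs (y ∷ ys)))
  (λ _ → ups-merge (x ∷ xs) ys)

downs-merge : ∀ xs ys → downs (merge xs ys) ≡ ys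
downs-merge []       []       = refl
downs-merge []       (y ∷ ys) = cong (y ∷_) (downs-merge [] ys)
downs-merge (x ∷ xs) []       = downs-merge xs []
downs-merge (x ∷ xs) (y ∷ ys) = merge-cases (λ w → downs w ≡ y ∷ ys) x xs y ys
  (λ _ → downs-merge xs (y ∷ ys))
  (λ _ → cong (y ∷_) (downs-merge (x ∷ xs) ys))

All-merge : ∀ {P : Letter → Set} xs ys →
            All (P ∘ up) xs → All (P ∘ down) ys → All P (merge xs ys)
All-merge []       []       _          _          = []
All-merge []       (y ∷ ys) _          (py ∷ pys) = py ∷ All-merge [] ys [] pys
All-merge (x ∷ xs) []       (px ∷ pxs) _          = px ∷ All-merge xs [] pxs []
All-merge {P} (x ∷ xs) (y ∷ ys) (px ∷ pxs) (py ∷ pys) = merge-cases (All P) x xs y ys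
  (λ _ → px ∷ All-merge xs (y ∷ ys) pxs (py ∷ pys))
  (λ _ → py ∷ All-merge (x ∷ xs) ys (px ∷ pxs) pys)

All-ups : ∀ {P : Letter → Set} w → All P w → All (P ∘ up) (ups w)
All-ups []           []         = []
All-ups (up v ∷ w)   (p ∷ ps)   = p ∷ All-ups w ps
All-ups (down v ∷ w) (_ ∷ ps)   = All-ups w ps

All-downs : ∀ {P : Letter → Set} w → All P w → All (P ∘ down) (downs w)
All-downs []           []       = []
All-downs (up v ∷ w)   (_ ∷ ps) = All-downs w ps
All-downs (down v ∷ w) (p ∷ ps) = p ∷ All-downs w ps

-- e ⊳ e′ : the letter e′ may follow e in a merged word.  Values decrease
-- weakly, and a part of β precedes a part of α of the same value.
infix 4 _⊳_
_⊳_ : Letter → Letter → Set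
up v   ⊳ down v′ = v′ < v
up v   ⊳ up v′   = v′ ≤ v
down v ⊳ e′      = value e′ ≤ v

up-⊳-value : ∀ {v e} → up v ⊳ e → value e ≤ v
up-⊳-value {e = up _}   o = o
up-⊳-value {e = down _} o = <⇒≤ o

⊳-trans : ∀ {e e′ e″} → e ⊳ e′ → e′ ⊳ e″ → e ⊳ e″
⊳-trans {up _}   {up _}   {up _}   p q = ≤-trans q p
⊳-trans {up _}   {up _}   {down _} p q = <-≤-trans q p
⊳-trans {up _}   {down _} {up _}   p q = ≤-trans q (<⇒≤ p)
⊳-trans {up _}   {down _} {down _} p q = ≤-<-trans q p
⊳-trans {down _} {up _}   {_}      p q = ≤-trans (up-⊳-value q) p
⊳-trans {down _} {down _} {_}      p q = ≤-trans q p

-- A word is valid if neighbouring letters are in order; these are exactly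
-- the words arising by merging two partitions.
Valid : Word → Set
Valid = Linked _⊳_

Nonincreasing : List ℕ → Set
Nonincreasing = AllPairs _≥_

merge-sorted : ∀ xs ys → Nonincreasing xs → Nonincreasing ys → AllPairs _⊳_ (merge xs ys)
merge-sorted []       []       _          _          = []
merge-sorted []       (y ∷ ys) _          (ay ∷ dy)  =
  All-merge [] ys [] ay ∷ merge-sorted [] ys [] dy
merge-sorted (x ∷ xs) []       (ax ∷ dx)  _          =
  All-merge xs [] ax [] ∷ merge-sorted xs [] dx []
merge-sorted (x ∷ xs) (y ∷ ys) (ax ∷ dx)  (ay ∷ dy)  =
  merge-cases (AllPairs _⊳_) x xs y ys
    (λ y<x → All-merge xs (y ∷ ys) ax (y<x ∷ All.map (λ z≤y → ≤-<-trans z≤y y<x) ay)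
             ∷ merge-sorted xs (y ∷ ys) dx (ay ∷ dy))
    (λ x≤y → All-merge (x ∷ xs) ys (x≤y ∷ All.map (λ z≤x → ≤-trans z≤x x≤y) ax) ay
             ∷ merge-sorted (x ∷ xs) ys (ax ∷ dx) dy)

merge-valid : ∀ xs ys → Nonincreasing xs → Nonincreasing ys → Valid (merge xs ys)
merge-valid xs ys dx dy = AllPairs⇒Linked (merge-sorted xs ys dx dy)

valid⇒sorted : ∀ {w} → Valid w → AllPairs _⊳_ w
valid⇒sorted = Linked⇒AllPairs ⊳-trans

merge-up-first : ∀ v xs ys → All (_< v) ys → merge (v ∷ xs) ys ≡ up v ∷ merge xs ys
merge-up-first v xs []       _          = refl
merge-up-first v xs (y ∷ ys) (y<v ∷ _)  = merge-cases (_≡ up v ∷ merge xs (y ∷ ys)) v xs y ys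
  (λ _ → refl) (λ v≤y → contradiction y<v (≤⇒≯ v≤y))

merge-down-first : ∀ v xs ys → All (_≤ v) xs → merge xs (v ∷ ys) ≡ down v ∷ merge xs ys
merge-down-first v []       ys _         = refl
merge-down-first v (x ∷ xs) ys (x≤v ∷ _) = merge-cases (_≡ down v ∷ merge (x ∷ xs) ys) x xs v ys
  (λ v<x → contradiction x≤v (<⇒≱ v<x)) (λ _ → refl)

merge-ups-downs : ∀ w → Valid w → merge (ups w) (downs w) ≡ w
merge-ups-downs w vw = go w (valid⇒sorted vw)
  where
  go : ∀ w → AllPairs _⊳_ w → merge (ups w) (downs w) ≡ w
  go []           []        = refl
  go (up v ∷ w)   (a ∷ aps) =
    trans (merge-up-first v (ups w) (downs w) (All-downs w a)) (cong (up v ∷_) (go w aps))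
  go (down v ∷ w) (a ∷ aps) =
    trans (merge-down-first v (ups w) (downs w) (All-ups w a)) (cong (down v ∷_) (go w aps))

valid-nonincreasing : ∀ w → Valid w → Nonincreasing (ups w) × Nonincreasing (downs w)
valid-nonincreasing w vw = go w (valid⇒sorted vw)
  where
  go : ∀ w → AllPairs _⊳_ w → Nonincreasing (ups w) × Nonincreasing (downs w)
  go []           []        = [] , []
  go (up v ∷ w)   (a ∷ aps) = All-ups w a ∷ proj₁ (go w aps) , proj₂ (go w aps)
  go (down v ∷ w) (a ∷ aps) = proj₁ (go w aps) , All-downs w a ∷ proj₂ (go w aps)

step : ℕ → Letter → ℕ
step h (up _)   = suc h
step h (down _) = pred h

endHeight : ℕ → Word → ℕ
endHeight h []      = h
endHeight h (e ∷ w) = endHeight (step h e) w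

-- Above c h w : the path of w started at height h stays at height ≥ c
-- (and, in particular, never steps down from height 0).
Above : ℕ → ℕ → Word → Set
Above c h       []           = c ≤ h
Above c h       (up _ ∷ w)   = c ≤ h × Above c (suc h) w
Above c zero    (down _ ∷ w) = ⊥
Above c (suc h) (down _ ∷ w) = Above c h w

above? : ∀ c h w → Dec (Above c h w)
above? c h       []           = c ≤? h
above? c h       (up _ ∷ w)   = (c ≤? h) ×-dec above? c (suc h) w
above? c zero    (down _ ∷ w) = no λ ()
above? c (suc h) (down _ ∷ w) = above? c h w

Reaches : ℕ → ℕ → Word → Set
Reaches c h []      = h ≤ c
Reaches c h (e ∷ w) = h ≤ c ⊎ Reaches c (step h e) w

above-start : ∀ {c} h w → Above c h w → c ≤ h
above-start h       []           c≤h       = c≤h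
above-start h       (up _ ∷ w)   (c≤h , _) = c≤h
above-start (suc h) (down _ ∷ w) ab        = m≤n⇒m≤1+n (above-start h w ab)

above-higher : ∀ {c} h w → Above c h w → Above c (suc h) w
above-higher h       []           c≤h        = m≤n⇒m≤1+n c≤h
above-higher h       (up _ ∷ w)   (c≤h , ab) = m≤n⇒m≤1+n c≤h , above-higher (suc h) w ab
above-higher (suc h) (down _ ∷ w) ab         = above-higher h w ab

above-lower : ∀ {c c′} h w → c′ ≤ c → Above c h w → Above c′ h w
above-lower h       []           c′≤c c≤h        = ≤-trans c′≤c c≤h
above-lower h       (up _ ∷ w)   c′≤c (c≤h , ab) = ≤-trans c′≤c c≤h , above-lower (suc h) w c′≤c ab
above-lower (suc h) (down _ ∷ w) c′≤c ab         = above-lower h w c′≤c ab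

above-reaches : ∀ {a c} h w → Above a h w → Reaches c h w → a ≤ c
above-reaches h       []           a≤h       h≤c        = ≤-trans a≤h h≤c
above-reaches h       (up _ ∷ w)   (a≤h , _) (inj₁ h≤c) = ≤-trans a≤h h≤c
above-reaches h       (up _ ∷ w)   (_ , ab)  (inj₂ re)  = above-reaches (suc h) w ab re
above-reaches (suc h) (down _ ∷ w) ab        (inj₁ h≤c) = ≤-trans (above-start h w ab) (≤-trans (n≤1+n h) h≤c)
above-reaches (suc h) (down _ ∷ w) ab        (inj₂ re)  = above-reaches h w ab re

¬above⇒reaches : ∀ c h w → ¬ Above (suc c) h w → Reaches c h w
¬above⇒reaches c h       []           ¬ab = ≮⇒≥ ¬ab
¬above⇒reaches c h       (up _ ∷ w)   ¬ab with h ≤? c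
... | yes h≤c = inj₁ h≤c
... | no  h≰c = inj₂ (¬above⇒reaches c (suc h) w (λ ab → ¬ab (≰⇒> h≰c , ab)))
¬above⇒reaches c zero    (down _ ∷ w) ¬ab = inj₁ z≤n
¬above⇒reaches c (suc h) (down _ ∷ w) ¬ab = inj₂ (¬above⇒reaches c h w ¬ab)

reaches-higher : ∀ {c c′} h w → c ≤ c′ → Reaches c h w → Reaches c′ h w
reaches-higher h []      c≤c′ h≤c        = ≤-trans h≤c c≤c′
reaches-higher h (e ∷ w) c≤c′ (inj₁ h≤c) = inj₁ (≤-trans h≤c c≤c′)
reaches-higher h (e ∷ w) c≤c′ (inj₂ re)  = inj₂ (reaches-higher (step h e) w c≤c′ re)

endHeight-count : ∀ {c} h w → Above c h w →
                  endHeight h w + length (downs w) ≡ h + length (ups w)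
endHeight-count h       []           _        = refl
endHeight-count h       (up _ ∷ w)   (_ , ab) = trans (endHeight-count (suc h) w ab) (sym (+-suc h _))
endHeight-count (suc h) (down _ ∷ w) ab       = trans (+-suc _ _) (cong suc (endHeight-count h w ab))

-- The credit f is the number of up-letters read so far minus the number of
-- down-letters not flipped; a down-letter read at credit 0 is *balanced*.
-- raise f w turns every balanced down-letter of w into an up-letter, and
-- balanced f w counts them.
raise : ℕ → Word → Word
raise f       []           = []
raise f       (up v ∷ w)   = up v ∷ raise (suc f) w
raise zero    (down v ∷ w) = up v ∷ raise zero w
raise (suc f) (down v ∷ w) = down v ∷ raise f w

balanced : ℕ → Word → ℕ
balanced f       []           = 0
balanced f       (up _ ∷ w)   = balanced (suc f) w
balanced zero    (down _ ∷ w) = suc (balanced zero w)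
balanced (suc f) (down _ ∷ w) = balanced f w

raise-values : ∀ f w → map value (raise f w) ≡ map value w
raise-values f       []           = refl
raise-values f       (up v ∷ w)   = cong (v ∷_) (raise-values (suc f) w)
raise-values zero    (down v ∷ w) = cong (v ∷_) (raise-values zero w)
raise-values (suc f) (down v ∷ w) = cong (v ∷_) (raise-values f w)

raise-#ups : ∀ f w → length (ups (raise f w)) ≡ length (ups w) + balanced f w
raise-#ups f       []           = refl
raise-#ups f       (up _ ∷ w)   = cong suc (raise-#ups (suc f) w)
raise-#ups zero    (down _ ∷ w) = trans (cong suc (raise-#ups zero w)) (sym (+-suc _ _))
raise-#ups (suc f) (down _ ∷ w) = raise-#ups f w

raise-#downs : ∀ f w → length (downs (raise f w)) + balanced f w ≡ length (downs w)
raise-#downs f       []           = refl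
raise-#downs f       (up _ ∷ w)   = raise-#downs (suc f) w
raise-#downs zero    (down _ ∷ w) = trans (+-suc _ _) (cong suc (raise-#downs zero w))
raise-#downs (suc f) (down _ ∷ w) = cong suc (raise-#downs f w)

-- Two neighbouring letters keep their relative order under raise: an
-- up-letter followed by a down-letter in the output was already so in the
-- input, since a balanced down-letter makes the next down-letter balanced.
raise-valid : ∀ f w → Valid w → Valid (raise f w)
raise-valid f             []                        []       = []
raise-valid f             (up _ ∷ [])               [-]      = [-]
raise-valid zero          (down _ ∷ [])             [-]      = [-]
raise-valid (suc f)       (down _ ∷ [])             [-]      = [-]
raise-valid f             (up _ ∷ up v ∷ w)         (o ∷ os) = o ∷ raise-valid (suc f) (up v ∷ w) os
raise-valid f             (up _ ∷ down v ∷ w)       (o ∷ os) = o ∷ raise-valid (suc f) (down v ∷ w) os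
raise-valid zero          (down _ ∷ up v ∷ w)       (o ∷ os) = o ∷ raise-valid zero (up v ∷ w) os
raise-valid zero          (down _ ∷ down v ∷ w)     (o ∷ os) = o ∷ raise-valid zero (down v ∷ w) os
raise-valid (suc f)       (down _ ∷ up v ∷ w)       (o ∷ os) = o ∷ raise-valid f (up v ∷ w) os
raise-valid (suc zero)    (down _ ∷ down v ∷ w)     (o ∷ os) = o ∷ raise-valid zero (down v ∷ w) os
raise-valid (suc (suc f)) (down _ ∷ down v ∷ w)     (o ∷ os) = o ∷ raise-valid (suc f) (down v ∷ w) os

-- Along raise f w started at height k + f, the height minus the credit never
-- decreases, so the path never goes below k.
raise-above : ∀ k f w → Above k (k + f) (raise f w)
raise-above k f       []           = m≤m+n k f
raise-above k f       (up _ ∷ w)   =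
  m≤m+n k f , subst (λ h → Above k h (raise (suc f) w)) (+-suc k f) (raise-above k (suc f) w)
raise-above k zero    (down _ ∷ w) =
  m≤m+n k 0 , above-higher (k + 0) (raise zero w) (raise-above k zero w)
raise-above k (suc f) (down v ∷ w) =
  subst (λ h → Above k h (down v ∷ raise f w)) (sym (+-suc k f)) (raise-above k f w)

-- Conversely, a balanced down-letter is read at height k + (number of flips so
-- far); if the raised path started at height h < k + f stays above k, no
-- down-letter is balanced.
raise-unbalanced : ∀ k h f w → Above k h (raise f w) → h < k + f → balanced f w ≡ 0
raise-unbalanced k h       f       []           _          _   = refl
raise-unbalanced k h       f       (up _ ∷ w)   (_ , ab)   h<  =
  raise-unbalanced k (suc h) (suc f) w ab (subst (suc h <_) (sym (+-suc k f)) (s≤s h<))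
raise-unbalanced k h       zero    (down _ ∷ w) (k≤h , _)  h<  =
  contradiction (≤-trans h< (subst (_≤ h) (sym (+-identityʳ k)) k≤h)) (<-irrefl refl)
raise-unbalanced k (suc h) (suc f) (down _ ∷ w) ab         h<  =
  raise-unbalanced k h f w ab (≤-pred (subst (suc (suc h) ≤_) (+-suc k f) h<))

-- Flips r h w : an up-letter read at height h, followed by w, is the last
-- step leaving the height h < r, i.e. the path never returns to h.
Flips : ℕ → ℕ → Word → Set
Flips r h w = h < r × Above (suc h) (suc h) w

flips? : ∀ r h w → Dec (Flips r h w)
flips? r h w = (h <? r) ×-dec above? (suc h) (suc h) w

lowerLetter : ℕ → ℕ → Letter → Word → Letter
lowerLetter r h (down v) w = down v
lowerLetter r h (up v)   w with flips? r h w
... | yes _ = down v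
... | no  _ = up v

lower : ℕ → ℕ → Word → Word
lower r h []      = []
lower r h (e ∷ w) = lowerLetter r h e w ∷ lower r (step h e) w

lowerLetter-flip : ∀ r h v w → Flips r h w → lowerLetter r h (up v) w ≡ down v
lowerLetter-flip r h v w fl with flips? r h w
... | yes _  = refl
... | no ¬fl = contradiction fl ¬fl

lowerLetter-keep : ∀ r h v w → ¬ Flips r h w → lowerLetter r h (up v) w ≡ up v
lowerLetter-keep r h v w ¬fl with flips? r h w
... | yes fl = contradiction fl ¬fl
... | no _   = refl

lower-values : ∀ r h w → map value (lower r h w) ≡ map value w
lower-values r h []           = refl
lower-values r h (down v ∷ w) = cong (v ∷_) (lower-values r (pred h) w)
lower-values r h (up v ∷ w)   = cong₂ _∷_ value-up (lower-values r (suc h) w)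
  where
  value-up : value (lowerLetter r h (up v) w) ≡ v
  value-up with flips? r h w
  ... | yes _ = refl
  ... | no  _ = refl

-- If an up-letter is kept, the up-letter right after it is kept as well: the
-- path leaving h + 1 for good also leaves h for good.
lower-⊳ : ∀ r h e e′ w → e ⊳ e′ → lowerLetter r h e (e′ ∷ w) ⊳ lowerLetter r (step h e) e′ w
lower-⊳ r h (down v) (down v′) w o = o
lower-⊳ r h (down v) (up v′)   w o with flips? r (pred h) w
... | yes _ = o
... | no  _ = o
lower-⊳ r h (up v)   (down v′) w o with flips? r h (down v′ ∷ w)
... | yes _ = <⇒≤ o
... | no  _ = o
lower-⊳ r h (up v)   (up v′)   w o with flips? r h (up v′ ∷ w) | flips? r (suc h) w
... | yes _  | yes _                   = o
... | yes _  | no  _                   = o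
... | no ¬fl | yes (1+h<r , ab)        =
  contradiction (<-trans (n<1+n h) 1+h<r , ≤-refl , above-lower (suc (suc h)) w (n≤1+n (suc h)) ab) ¬fl
... | no  _  | no  _                   = o

lower-valid : ∀ r h w → Valid w → Valid (lower r h w)
lower-valid r h []           []       = []
lower-valid r h (e ∷ [])     [-]      = [-]
lower-valid r h (e ∷ e′ ∷ w) (o ∷ os) = lower-⊳ r h e e′ w o ∷ lower-valid r (step h e) (e′ ∷ w) os

-- lower undoes raise: having done c flips, the raised path is at height f + c,
-- and the next flip happens exactly when it last leaves height c.
lower-raise : ∀ c f w → lower (c + balanced f w) (f + c) (raise f w) ≡ w
lower-raise c f       []           = refl
lower-raise c f       (up v ∷ w)   =
  cong₂ _∷_ (lowerLetter-keep _ _ v _ no-flip) (lower-raise c (suc f) w)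
  where
  no-flip : ¬ Flips (c + balanced (suc f) w) (f + c) (raise (suc f) w)
  no-flip (h<r , ab) = <⇒≱ h<r (begin
    c + balanced (suc f) w ≡⟨ cong (c +_) (raise-unbalanced (suc (f + c)) (suc (f + c)) (suc f) w ab (m<m+n _ z<s)) ⟩
    c + 0                  ≡⟨ +-identityʳ c ⟩
    c                      ≤⟨ m≤n+m c f ⟩
    f + c                  ∎)
    where open ≤-Reasoning
lower-raise c zero    (down v ∷ w) =
  cong₂ _∷_ (lowerLetter-flip _ _ v _ (c<r , ab)) (subst (λ r → lower r (suc c) (raise zero w) ≡ w) (sym (+-suc c _)) (lower-raise (suc c) zero w))
  where
  c<r : c < c + suc (balanced zero w)
  c<r = m<m+n c z<s
  ab : Above (suc c) (suc c) (raise zero w)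
  ab = subst (λ h → Above (suc c) h (raise zero w)) (+-identityʳ (suc c)) (raise-above (suc c) zero w)
lower-raise c (suc f) (down v ∷ w) = cong (down v ∷_) (lower-raise c f w)

reaches-start : ∀ c h w → h ≤ c → Reaches c h w
reaches-start c h []      h≤c = h≤c
reaches-start c h (e ∷ w) h≤c = inj₁ h≤c

flip-at-floor : ∀ {r c h} v w → c ≤ h → Flips r h w → (c < r → Reaches c h (up v ∷ w)) → h ≡ c
flip-at-floor v w c≤h (h<r , ab) reach with reach (≤-<-trans c≤h h<r)
... | inj₁ h≤c = ≤-antisym h≤c c≤h
... | inj₂ re  = contradiction (≤-trans (above-reaches _ w ab re) c≤h) (<-irrefl refl)

reaches-after-keep : ∀ {r c h} v w → ¬ Flips r h w → (c < r → Reaches c h (up v ∷ w)) →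
                     c < r → Reaches c (suc h) w
reaches-after-keep {r} {c} {h} v w ¬fl reach c<r with reach c<r
... | inj₂ re  = re
... | inj₁ h≤c with above? (suc h) (suc h) w
...   | yes ab = contradiction (≤-<-trans h≤c c<r , ab) ¬fl
...   | no ¬ab = reaches-higher (suc h) w h≤c (¬above⇒reaches h (suc h) w ¬ab)

-- Invariant: w is read at height h = f + c after c flips
-- with credit f; the path of w stays above c and, while flips are missing
-- (c < r), returns to c.
raise-lower : ∀ r c f h w → h ≡ f + c → c ≤ r → Above c h w → (c < r → Reaches c h w) →
              raise f (lower r h w) ≡ w × (r ≤ endHeight h w → c + balanced f (lower r h w) ≡ r)
raise-lower r c f h [] _ c≤r _ reach = refl , all-flipped
  where
  all-flipped : r ≤ h → c + 0 ≡ r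
  all-flipped r≤h with c <? r
  ... | yes c<r = contradiction (≤-trans c<r (≤-trans r≤h (reach c<r))) (<-irrefl refl)
  ... | no  c≮r = trans (+-identityʳ c) (≤-antisym c≤r (≮⇒≥ c≮r))
raise-lower r c zero    (suc h) (down v ∷ w) h≡c _ ab _ =
  contradiction (≤-trans (≤-reflexive h≡c) (above-start h w ab)) (<-irrefl refl)
raise-lower r c (suc f) (suc h) (down v ∷ w) h≡f+c c≤r ab reach =
  let (inverse , count) = raise-lower r c f h w (suc-injective h≡f+c) c≤r ab reach′
  in cong (down v ∷_) inverse , count
  where
  reach′ : c < r → Reaches c h w
  reach′ c<r with reach c<r
  ... | inj₁ 1+h≤c = contradiction (≤-trans 1+h≤c (above-start h w ab)) (<-irrefl refl)
  ... | inj₂ re    = re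
raise-lower r c f h (up v ∷ w) h≡f+c c≤r (c≤h , ab) reach with flips? r h w
... | no ¬fl =
  let (inverse , count) = raise-lower r c (suc f) (suc h) w (cong suc h≡f+c) c≤r ab (reaches-after-keep v w ¬fl reach)
  in cong (up v ∷_) inverse , count
... | yes fl@(h<r , ab′) with flip-at-floor v w c≤h fl reach
...   | refl rewrite +-cancelʳ-≡ h f 0 (sym h≡f+c) =
  let (inverse , count) = raise-lower r (suc h) 0 (suc h) w refl h<r ab′ (λ _ → reaches-start (suc h) (suc h) w ≤-refl)
  in cong (up v ∷_) inverse , λ r≤end → trans (+-suc h _) (count r≤end)

countGt-none : ∀ y xs → All (_≤ y) xs → countGt y xs ≡ 0
countGt-none y []       []           = refl
countGt-none y (x ∷ xs) (x≤y ∷ xs≤y) rewrite dec-false (y <? x) (≤⇒≯ x≤y) = countGt-none y xs xs≤y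

countGt-prefix : ∀ y P xs → All (y <_) P → All (_≤ y) xs → countGt y (P ++ xs) ≡ length P
countGt-prefix y []      xs []          xs≤y = countGt-none y xs xs≤y
countGt-prefix y (p ∷ P) xs (y<p ∷ y<P) xs≤y rewrite dec-true (y <? p) y<p =
  cong suc (countGt-prefix y P xs y<P xs≤y)

nth-suffix : ∀ y P xs k → length P ≤ k → All (_≤ y) xs → nth (P ++ xs) k ≤ y
nth-suffix y []      []       k       _         _          = z≤n
nth-suffix y []      (x ∷ xs) zero    _         (x≤y ∷ _)  = x≤y
nth-suffix y []      (x ∷ xs) (suc k) _         (_ ∷ xs≤y) = nth-suffix y [] xs k z≤n xs≤y
nth-suffix y (p ∷ P) xs       (suc k) (s≤s P≤k) xs≤y       = nth-suffix y P xs k P≤k xs≤y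

-- The test of Defs deciding whether the part y = β_(k+1) is balanced, when the
-- parts α_2, … of α are split as P ++ xs with P the parts exceeding y, u parts
-- of β were unbalanced so far and f + u = length P: y is balanced iff f = 0.
balanced-test : ∀ a y P xs k u f → All (y <_) P → All (_≤ y) xs → f + u ≡ length P → u ≤ k →
                (nth (a ∷ P ++ xs) (suc k) ≤ᵇ y) ∧ (countGt y (drop 1 (a ∷ P ++ xs)) ≡ᵇ u) ≡ (f ≡ᵇ 0)
balanced-test a y P xs k u f y<P xs≤y f+u≡P u≤k rewrite countGt-prefix y P xs y<P xs≤y with f
... | zero  = cong₂ _∧_ (dec-true (nth (P ++ xs) k ≤? y) (nth-suffix y P xs k P≤k xs≤y))
                        (dec-true (length P ≟ u) (sym f+u≡P))
  where P≤k = ≤-trans (≤-reflexive (sym f+u≡P)) u≤k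
... | suc f = trans (cong ((nth (P ++ xs) k ≤ᵇ y) ∧_) (dec-false (length P ≟ u) P≢u)) (∧-zeroʳ _)
  where
  P≢u : length P ≢ u
  P≢u P≡u = <⇒≢ (m<n+m u z<s) (sym (trans f+u≡P P≡u))

balAux-down : ∀ a P xs y ys k u f rest → All (y <_) P → All (_≤ y) xs → f + u ≡ length P → u ≤ k →
              (∀ k′ u′ f′ → f′ + u′ ≡ length P → u′ ≤ k′ → balAux (a ∷ P ++ xs) k′ u′ ys ≡ balanced f′ rest) →
              balAux (a ∷ P ++ xs) k u (y ∷ ys) ≡ balanced f (down y ∷ rest)
balAux-down a P xs y ys k u zero    rest y<P xs≤y f+u≡P u≤k next
  rewrite balanced-test a y P xs k u zero y<P xs≤y f+u≡P u≤k =
  cong suc (next (suc k) u zero f+u≡P (m≤n⇒m≤1+n u≤k))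
balAux-down a P xs y ys k u (suc f) rest y<P xs≤y f+u≡P u≤k next
  rewrite balanced-test a y P xs k u (suc f) y<P xs≤y f+u≡P u≤k =
  next (suc k) (suc u) f (trans (+-suc f u) f+u≡P) (s≤s u≤k)

-- Passing a part x of α during the merge: it joins the parts exceeding the
-- remaining parts of β, and raises the credit by one.
pass : ∀ {P ys} x → All (λ y → All (y <_) P) ys → All (_< x) ys → All (λ y → All (y <_) (P ++ [ x ])) ys
pass x ys<P ys<x = All.zipWith (λ (y<P , y<x) → ++⁺ y<P (y<x ∷ [])) (ys<P , ys<x)

passed-length : ∀ (P : List ℕ) x f u → f + u ≡ length P → suc f + u ≡ length (P ++ [ x ])
passed-length P x f u f+u≡P = trans (cong suc f+u≡P) (trans (+-comm 1 (length P)) (sym (length-++ P)))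

-- Invariant: the parts P of α already passed exceed all
-- remaining parts of β; the credit f plus the number u of unbalanced parts
-- so far is length P; and u is at most the number k of parts of β read.
balAux-merge : ∀ a xs ys P k u f → Nonincreasing xs → Nonincreasing ys →
               All (λ y → All (y <_) P) ys → f + u ≡ length P → u ≤ k →
               balAux (a ∷ P ++ xs) k u ys ≡ balanced f (merge xs ys)
balAux-merge a []       []       P k u f _         _          _              _     _   = refl
balAux-merge a []       (y ∷ ys) P k u f _         (_ ∷ dys)  (y<P ∷ ys<P)   f+u≡P u≤k =
  balAux-down a P [] y ys k u f (merge [] ys) y<P [] f+u≡P u≤k
    (λ k′ u′ f′ → balAux-merge a [] ys P k′ u′ f′ [] dys ys<P)
balAux-merge a (x ∷ xs) []       P k u f (_ ∷ dxs) _          _              f+u≡P u≤k =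
  balAux-merge a xs [] (P ++ [ x ]) k u (suc f) dxs [] [] (passed-length P x f u f+u≡P) u≤k
balAux-merge a (x ∷ xs) (y ∷ ys) P k u f (ax ∷ dxs) (ay ∷ dys) (y<P ∷ ys<P) f+u≡P u≤k =
  merge-cases (λ w → balAux (a ∷ P ++ x ∷ xs) k u (y ∷ ys) ≡ balanced f w) x xs y ys
    (λ y<x → subst (λ L → balAux (a ∷ L) k u (y ∷ ys) ≡ balanced (suc f) (merge xs (y ∷ ys)))
                   (++-assoc P [ x ] xs)
                   (balAux-merge a xs (y ∷ ys) (P ++ [ x ]) k u (suc f) dxs (ay ∷ dys)
                     (pass x (y<P ∷ ys<P) (y<x ∷ All.map (λ z≤y → ≤-<-trans z≤y y<x) ay))
                     (passed-length P x f u f+u≡P) u≤k))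
    (λ x≤y → balAux-down a P (x ∷ xs) y ys k u f (merge (x ∷ xs) ys) y<P
               (x≤y ∷ All.map (λ z≤x → ≤-trans z≤x x≤y) ax) f+u≡P u≤k
               (λ k′ u′ f′ → balAux-merge a (x ∷ xs) ys P k′ u′ f′ (ax ∷ dxs) dys ys<P))

balancedParts-merge : ∀ a xs ys → Nonincreasing xs → Nonincreasing ys →
                      balancedParts (a ∷ xs) ys ≡ balanced 0 (merge xs ys)
balancedParts-merge a xs ys dxs dys = balAux-merge a xs ys [] 0 0 0 dxs dys (All.universal (λ _ → []) ys) refl z≤n

-- Shifted h xs ys : after the first h parts of ys, the k-th part of ys is
-- smaller than the (k - h)-th part of xs (and all such parts of xs exist).
-- Shifted 0 xs ys says that (a ∷ xs , ys) is strict shifted.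
Shifted : ℕ → List ℕ → List ℕ → Set
Shifted h       xs       []       = ⊤
Shifted zero    []       (y ∷ ys) = ⊥
Shifted zero    (x ∷ xs) (y ∷ ys) = y < x × Shifted zero xs ys
Shifted (suc h) xs       (y ∷ ys) = Shifted h xs ys

shifted-pass : ∀ h x xs ys → Shifted h (x ∷ xs) ys → Shifted (suc h) xs ys
shifted-pass h       x xs []       _        = tt
shifted-pass zero    x xs (y ∷ ys) (_ , sh) = sh
shifted-pass (suc h) x xs (y ∷ ys) sh       = shifted-pass h x xs ys sh

shifted-unpass : ∀ h x xs ys → All (_< x) ys → Shifted (suc h) xs ys → Shifted h (x ∷ xs) ys
shifted-unpass h       x xs []       _           _  = tt
shifted-unpass zero    x xs (y ∷ ys) (y<x ∷ _)   sh = y<x , sh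
shifted-unpass (suc h) x xs (y ∷ ys) (_ ∷ ys<x)  sh = shifted-unpass h x xs ys ys<x sh

-- Strict shiftedness is the condition that the path of the merged word
-- never goes below 0: each part β_j has at least j larger parts among α_2, ….
shifted⇒above : ∀ h xs ys → Shifted h xs ys → Above 0 h (merge xs ys)
shifted⇒above h       []       []       _  = z≤n
shifted⇒above (suc h) []       (y ∷ ys) sh = shifted⇒above h [] ys sh
shifted⇒above h       (x ∷ xs) []       _  = z≤n , shifted⇒above (suc h) xs [] tt
shifted⇒above h       (x ∷ xs) (y ∷ ys) sh = merge-cases (Above 0 h) x xs y ys
  (λ _   → z≤n , shifted⇒above (suc h) xs (y ∷ ys) (shifted-pass h x xs (y ∷ ys) sh))
  (λ x≤y → down-step h x≤y sh)
  where
  down-step : ∀ h → x ≤ y → Shifted h (x ∷ xs) (y ∷ ys) → Above 0 h (down y ∷ merge (x ∷ xs) ys)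
  down-step zero    x≤y (y<x , _) = <⇒≱ y<x x≤y
  down-step (suc h) _   sh        = shifted⇒above h (x ∷ xs) ys sh

above⇒shifted : ∀ h w → Valid w → Above 0 h w → Shifted h (ups w) (downs w)
above⇒shifted h w vw = go h w (valid⇒sorted vw)
  where
  go : ∀ h w → AllPairs _⊳_ w → Above 0 h w → Shifted h (ups w) (downs w)
  go h       []           _         _        = tt
  go h       (up v ∷ w)   (a ∷ aps) (_ , ab) = shifted-unpass h v (ups w) (downs w) (All-downs w a) (go (suc h) w aps ab)
  go (suc h) (down v ∷ w) (_ ∷ aps) ab       = go h w aps ab

split∧ : ∀ {x y} → T (x ∧ y) → T x × T y
split∧ = Equivalence.to T-∧

join∧ : ∀ {x y} → T x → T y → T (x ∧ y)
join∧ p q = Equivalence.from T-∧ (p , q)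

allB⁻ : ∀ {A : Set} (p : A → Bool) xs → T (allB p xs) → All (T ∘ p) xs
allB⁻ p []       _ = []
allB⁻ p (x ∷ xs) t = let (px , pxs) = split∧ t in px ∷ allB⁻ p xs pxs

allB⁺ : ∀ {A : Set} (p : A → Bool) xs → All (T ∘ p) xs → T (allB p xs)
allB⁺ p []       []         = tt
allB⁺ p (x ∷ xs) (px ∷ pxs) = join∧ px (allB⁺ p xs pxs)

pointwise⇒shifted : ∀ xs ys → (∀ {k} → k < length ys → nth ys k < nth xs k) → Shifted 0 xs ys
pointwise⇒shifted xs       []       _  = tt
pointwise⇒shifted []       (y ∷ ys) lt with lt z<s
... | ()
pointwise⇒shifted (x ∷ xs) (y ∷ ys) lt = lt z<s , pointwise⇒shifted xs ys (lt ∘ s<s)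

shifted⇒pointwise : ∀ xs ys → Shifted 0 xs ys → ∀ {k} → k < length ys → nth ys k < nth xs k
shifted⇒pointwise (x ∷ xs) (y ∷ ys) (y<x , _)  {zero}  _         = y<x
shifted⇒pointwise (x ∷ xs) (y ∷ ys) (_ , sh)   {suc k} (s<s k<n) = shifted⇒pointwise xs ys sh k<n

shifted⇒length : ∀ xs ys → Shifted 0 xs ys → length ys ≤ length xs
shifted⇒length xs       []       _        = z≤n
shifted⇒length (x ∷ xs) (y ∷ ys) (_ , sh) = s≤s (shifted⇒length xs ys sh)

strictShifted⇒shifted : ∀ a xs ys → T (isStrictShifted (a ∷ xs) ys) → Shifted 0 xs ys
strictShifted⇒shifted a xs ys t = pointwise⇒shifted xs ys
  (λ {k} k<n → <ᵇ⇒< _ _ (applyUpTo⁻ id (length ys) (allB⁻ _ (upTo (length ys)) (proj₂ (split∧ t))) k<n))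

shifted⇒strictShifted : ∀ a xs ys → Shifted 0 xs ys → T (isStrictShifted (a ∷ xs) ys)
shifted⇒strictShifted a xs ys sh = join∧ (<⇒<ᵇ (s≤s (shifted⇒length xs ys sh)))
  (allB⁺ _ (upTo (length ys)) (applyUpTo⁺₁ id (length ys) (λ k<n → <⇒<ᵇ (shifted⇒pointwise xs ys sh k<n))))

Partition : List ℕ → Set
Partition xs = Nonincreasing xs × All (0 <_) xs

isPartition⇒ : ∀ xs → T (isPartition xs) → Partition xs
isPartition⇒ xs t = let (linked , positive) = go xs t in Linked⇒AllPairs (λ i≥j j≥k → ≤-trans j≥k i≥j) linked , positive
  where
  go : ∀ xs → T (isPartition xs) → Linked _≥_ xs × All (0 <_) xs
  go []           _ = [] , []
  go (x ∷ [])     t = [-] , ≤ᵇ⇒≤ 1 x t ∷ []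
  go (x ∷ y ∷ xs) t =
    let (y≤ᵇx , t′) = split∧ t
        (linked , positive) = go (y ∷ xs) t′
        y≤x = ≤ᵇ⇒≤ y x y≤ᵇx
    in y≤x ∷ linked , ≤-trans (All.head positive) y≤x ∷ positive

⇒isPartition : ∀ xs → Partition xs → T (isPartition xs)
⇒isPartition xs (nonincreasing , positive) = go xs (AllPairs⇒Linked nonincreasing) positive
  where
  go : ∀ xs → Linked _≥_ xs → All (0 <_) xs → T (isPartition xs)
  go []           _              _              = tt
  go (x ∷ [])     _              (0<x ∷ [])     = ≤⇒≤ᵇ 0<x
  go (x ∷ y ∷ xs) (y≤x ∷ linked) (_ ∷ positive) = join∧ (≤⇒≤ᵇ y≤x) (go (y ∷ xs) linked positive)

Fits : ℕ → Letter → Set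
Fits a e = 0 < value e × value e ≤ a

nth-first : ∀ {a} xs → All (_≤ a) xs → nth xs 0 ≤ a
nth-first []       []        = z≤n
nth-first (x ∷ xs) (x≤a ∷ _) = x≤a

first⇒all : ∀ {a} xs → Nonincreasing xs → nth xs 0 ≤ a → All (_≤ a) xs
first⇒all []       []         _   = []
first⇒all (x ∷ xs) (x≥xs ∷ _) x≤a = x≤a ∷ All.map (λ y≤x → ≤-trans y≤x x≤a) x≥xs

encode : ∀ {a} xs β → Partition (a ∷ xs) → Partition β → nth β 0 ≤ a →
         Valid (merge xs β) × All (Fits a) (merge xs β)
encode xs β (a≥xs ∷ dxs , _ ∷ pxs) (dβ , pβ) β₁≤a =
  merge-valid xs β dxs dβ ,
  All-merge xs β (All.zip (pxs , a≥xs)) (All.zip (pβ , first⇒all β dβ β₁≤a))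

decode : ∀ {a} w → 0 < a → Valid w → All (Fits a) w →
         Partition (a ∷ ups w) × Partition (downs w) × nth (downs w) 0 ≤ a
decode {a} w 0<a vw fits =
  let (dups , ddowns) = valid-nonincreasing w vw
      (positive , ≤a) = All.unzip fits
  in (All-ups w ≤a ∷ dups , 0<a ∷ All-ups w positive) ,
     (ddowns , All-downs w positive) ,
     nth-first (downs w) (All-downs w ≤a)

sum-ups-downs : ∀ w → sum (ups w) + sum (downs w) ≡ sum (map value w)
sum-ups-downs []           = refl
sum-ups-downs (up v ∷ w)   = trans (+-assoc v _ _) (cong (v +_) (sum-ups-downs w))
sum-ups-downs (down v ∷ w) = trans (x∙yz≈y∙xz (sum (ups w)) v _) (cong (v +_) (sum-ups-downs w))

size-decode : ∀ a w → size (a ∷ ups w) + size (downs w) ≡ a + sum (map value w)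
size-decode a w = trans (+-assoc a _ _) (cong (a +_) (sum-ups-downs w))

record Encodes (n a : ℕ) (w : Word) : Set where
  field
    first-positive : 0 < a
    valid          : Valid w
    fits           : All (Fits a) w
    total          : a + sum (map value w) ≡ n

encodes-along : ∀ {n a w w′} → map value w′ ≡ map value w → Valid w′ → Encodes n a w → Encodes n a w′
encodes-along {n} {a} values≡ vw′ enc = record
  { first-positive = first-positive
  ; valid          = vw′
  ; fits           = map⁻ (subst (All (λ v → 0 < v × v ≤ a)) (sym values≡) (map⁺ fits))
  ; total          = trans (cong (λ vs → a + sum vs) values≡) total
  }
  where open Encodes enc

isPairA : ℕ → ℕ → ℕ → List ℕ → List ℕ → Bool
isPairA r m n α β =
     isPartition α ∧ isPartition β
   ∧ (size α + size β ≡ᵇ n)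
   ∧ (nth β 0 ≤ᵇ nth α 0)
   ∧ (balancedParts α β ≡ᵇ r)
   ∧ (len α ≡ᵇ len β + m)

isPairB : ℕ → ℕ → ℕ → List ℕ → List ℕ → Bool
isPairB r m n α β =
     isPartition α ∧ isPartition β
   ∧ isStrictShifted α β
   ∧ (size α + size β ≡ᵇ n)
   ∧ (len α ≡ᵇ len β + (m + 2 * r))

record WordA (r m n a : ℕ) (w : Word) : Set where
  field
    encodes   : Encodes n a w
    balanced≡ : balanced 0 w ≡ r
    length≡   : suc (length (ups w)) ≡ length (downs w) + m

record WordB (r m n a : ℕ) (w : Word) : Set where
  field
    encodes : Encodes n a w
    above   : Above 0 0 w
    length≡ : suc (length (ups w)) ≡ length (downs w) + (m + 2 * r)

total-merge : ∀ a xs β {n} → size (a ∷ xs) + size β ≡ n → a + sum (map value (merge xs β)) ≡ n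
total-merge a xs β size≡ = begin
  a + sum (map value (merge xs β))                          ≡⟨ size-decode a (merge xs β) ⟨
  size (a ∷ ups (merge xs β)) + size (downs (merge xs β))   ≡⟨ cong₂ (λ α β → size (a ∷ α) + size β) (ups-merge xs β) (downs-merge xs β) ⟩
  size (a ∷ xs) + size β                                    ≡⟨ size≡ ⟩
  _                                                         ∎
  where open ≡-Reasoning

length-merge : ∀ xs β k → suc (length xs) ≡ length β + k →
               suc (length (ups (merge xs β))) ≡ length (downs (merge xs β)) + k
length-merge xs β k = subst₂ (λ α β → suc (length α) ≡ length β + k) (sym (ups-merge xs β)) (sym (downs-merge xs β))

pairA⇒wordA : ∀ {r m n} a xs β → T (isPairA r m n (a ∷ xs) β) → WordA r m n a (merge xs β)
pairA⇒wordA {r} {m} {n} a xs β t =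
  let (pα , t₁) = split∧ t ; (pβ , t₂) = split∧ t₁ ; (size≡ , t₃) = split∧ t₂
      (β₁≤a , t₄) = split∧ t₃ ; (balanced≡ , length≡) = split∧ t₄
      partα = isPartition⇒ (a ∷ xs) pα
      partβ = isPartition⇒ β pβ
      (valid , fits) = encode xs β partα partβ (≤ᵇ⇒≤ _ _ β₁≤a)
  in record
    { encodes   = record { first-positive = All.head (proj₂ partα) ; valid = valid ; fits = fits
                         ; total = total-merge a xs β (≡ᵇ⇒≡ _ _ size≡) }
    ; balanced≡ = trans (sym (balancedParts-merge a xs β (AllPairs.tail (proj₁ partα)) (proj₁ partβ))) (≡ᵇ⇒≡ _ _ balanced≡)
    ; length≡   = length-merge xs β _ (≡ᵇ⇒≡ _ _ length≡)
    }

decode-size : ∀ {n a} w → Encodes n a w → T (size (a ∷ ups w) + size (downs w) ≡ᵇ n)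
decode-size {a = a} w enc = ≡⇒≡ᵇ _ _ (trans (size-decode a w) (Encodes.total enc))

wordA⇒pairA : ∀ {r m n a} w → WordA r m n a w → T (isPairA r m n (a ∷ ups w) (downs w))
wordA⇒pairA {a = a} w wa =
  let open WordA wa
      open Encodes encodes
      (partα , partβ , β₁≤a) = decode w first-positive valid fits
  in join∧ (⇒isPartition _ partα) (join∧ (⇒isPartition _ partβ) (join∧ (decode-size w encodes)
       (join∧ (≤⇒≤ᵇ β₁≤a) (join∧ (≡⇒≡ᵇ _ _ (balancedParts-decode partα partβ)) (≡⇒≡ᵇ _ _ length≡)))))
  where
  balancedParts-decode : Partition (a ∷ ups w) → Partition (downs w) → balancedParts (a ∷ ups w) (downs w) ≡ _
  balancedParts-decode (_ ∷ dups , _) (ddowns , _) = begin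
    balancedParts (a ∷ ups w) (downs w)      ≡⟨ balancedParts-merge a (ups w) (downs w) dups ddowns ⟩
    balanced 0 (merge (ups w) (downs w))     ≡⟨ cong (balanced 0) (merge-ups-downs w (Encodes.valid (WordA.encodes wa))) ⟩
    balanced 0 w                             ≡⟨ WordA.balanced≡ wa ⟩
    _                                        ∎
    where open ≡-Reasoning

-- Under strict shiftedness β₁ < α₂ ≤ α₁, so the first part of β is bounded by a.
shifted-first : ∀ {a} xs ys → Shifted 0 xs ys → All (_≤ a) xs → nth ys 0 ≤ a
shifted-first xs       []       _        _         = z≤n
shifted-first (x ∷ xs) (y ∷ ys) (y<x , _) (x≤a ∷ _) = ≤-trans (<⇒≤ y<x) x≤a

pairB⇒wordB : ∀ {r m n} a xs β → T (isPairB r m n (a ∷ xs) β) → WordB r m n a (merge xs β)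
pairB⇒wordB {r} {m} {n} a xs β t =
  let (pα , t₁) = split∧ t ; (pβ , t₂) = split∧ t₁ ; (strict , t₃) = split∧ t₂
      (size≡ , length≡) = split∧ t₃
      partα = isPartition⇒ (a ∷ xs) pα
      shifted = strictShifted⇒shifted a xs β strict
      (valid , fits) = encode xs β partα (isPartition⇒ β pβ) (shifted-first xs β shifted (AllPairs.head (proj₁ partα)))
  in record
    { encodes = record { first-positive = All.head (proj₂ partα) ; valid = valid ; fits = fits
                       ; total = total-merge a xs β (≡ᵇ⇒≡ _ _ size≡) }
    ; above   = shifted⇒above 0 xs β shifted
    ; length≡ = length-merge xs β _ (≡ᵇ⇒≡ _ _ length≡)
    }

wordB⇒pairB : ∀ {r m n a} w → WordB r m n a w → T (isPairB r m n (a ∷ ups w) (downs w))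
wordB⇒pairB {a = a} w wb =
  let open WordB wb
      open Encodes encodes
      (partα , partβ , _) = decode w first-positive valid fits
  in join∧ (⇒isPartition _ partα) (join∧ (⇒isPartition _ partβ)
       (join∧ (shifted⇒strictShifted a (ups w) (downs w) (above⇒shifted 0 w valid above))
       (join∧ (decode-size w encodes) (≡⇒≡ᵇ _ _ length≡))))

two-flips : ∀ d r m → (d + r) + m + r ≡ d + (m + 2 * r)
two-flips = solve-∀

-- raise maps the words of the first kind to words of the second kind: each of
-- the r flips moves one part from β to α, changing l(α) - l(β) by 2.
raise-AB : ∀ {r m n a} w → WordA r m n a w → WordB r m n a (raise 0 w)
raise-AB {r} {m} w wa = record
  { encodes = encodes-along (raise-values 0 w) (raise-valid 0 w valid) encodes
  ; above   = raise-above 0 0 w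
  ; length≡ = begin
      suc (length (ups (raise 0 w)))             ≡⟨ cong suc (raise-#ups 0 w) ⟩
      suc (length (ups w) + balanced 0 w)        ≡⟨ cong (λ b → suc (length (ups w) + b)) balanced≡ ⟩
      suc (length (ups w)) + r                   ≡⟨ cong (_+ r) length≡ ⟩
      length (downs w) + m + r                   ≡⟨ cong (λ d → d + m + r) downs≡ ⟨
      (D′ + r) + m + r                           ≡⟨ two-flips D′ r m ⟩
      D′ + (m + 2 * r)                           ∎
  }
  where
  open WordA wa
  open Encodes encodes
  open ≡-Reasoning
  D′ = length (downs (raise 0 w))
  downs≡ : D′ + r ≡ length (downs w)
  downs≡ = subst (λ b → D′ + b ≡ length (downs w)) balanced≡ (raise-#downs 0 w)

-- A path from 0 to height m + 2r - 1 (r ≥ 1) ends at height at least r.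
end-height-bound : ∀ r m e d u → e + d ≡ u → suc u ≡ d + (m + 2 * r) → r ≤ e
end-height-bound zero     m e d u _    _    = z≤n
end-height-bound (suc r′) m e d u e+d≡u 1+u≡ =
  subst (suc r′ ≤_) (sym e≡) (m≤n+m (suc r′) (m + r′))
  where
  e≡ : e ≡ (m + r′) + suc r′
  e≡ = +-cancelʳ-≡ d _ _ (suc-injective (trans (cong suc e+d≡u) (trans 1+u≡ (rearrange d m r′))))
    where
    rearrange : ∀ d m r′ → d + (m + 2 * suc r′) ≡ suc ((m + r′) + suc r′ + d)
    rearrange = solve-∀

lower-BA : ∀ {r m n a} w → WordB r m n a w → WordA r m n a (lower r 0 w) × raise 0 (lower r 0 w) ≡ w
lower-BA {r} {m} w wb = record
  { encodes   = encodes-along (lower-values r 0 w) (lower-valid r 0 w valid) encodes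
  ; balanced≡ = balanced≡
  ; length≡   = +-cancelʳ-≡ r _ _ (begin
      suc (U″ + r)                ≡⟨ cong suc ups≡ ⟨
      suc (length (ups w))        ≡⟨ length≡ ⟩
      length (downs w) + (m + 2 * r) ≡⟨ two-flips (length (downs w)) r m ⟨
      (length (downs w) + r) + m + r ≡⟨ cong (λ d → d + m + r) downs≡ ⟩
      D″ + m + r                  ∎)
  } , inverse
  where
  open WordB wb
  open Encodes encodes
  open ≡-Reasoning
  w″ = lower r 0 w
  U″ = length (ups w″)
  D″ = length (downs w″)
  inverse-and-count = raise-lower r 0 0 0 w refl z≤n above (λ _ → reaches-start 0 0 w z≤n)
  inverse : raise 0 w″ ≡ w
  inverse = proj₁ inverse-and-count
  balanced≡ : balanced 0 w″ ≡ r
  balanced≡ = proj₂ inverse-and-count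
    (end-height-bound r m (endHeight 0 w) (length (downs w)) (length (ups w)) (endHeight-count 0 w above) length≡)
  ups≡ : length (ups w) ≡ U″ + r
  ups≡ = subst₂ (λ x b → length (ups x) ≡ U″ + b) inverse balanced≡ (raise-#ups 0 w″)
  downs≡ : length (downs w) + r ≡ D″
  downs≡ = subst₂ (λ x b → length (downs x) + b ≡ D″) inverse balanced≡ (raise-#downs 0 w″)

lower-raise-A : ∀ {r m n a} w → WordA r m n a w → lower r 0 (raise 0 w) ≡ w
lower-raise-A w wa = subst (λ r → lower r 0 (raise 0 w) ≡ w) (WordA.balanced≡ wa) (lower-raise 0 0 w)

Pair : Set
Pair = List ℕ × List ℕ

InA InB : ℕ → ℕ → ℕ → Pair → Set
InA r m n (α , β) = T (isPairA r m n α β)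
InB r m n (α , β) = T (isPairB r m n α β)

-- A pair with empty α lies in neither set (the conjuncts about α = [] are
-- evaluated away: α has size 0 and β₁ ≤ 0; l(β) < 0).
no-empty-A : ∀ r m n β → 1 ≤ n → ¬ InA r m n ([] , β)
no-empty-A r m n []      1≤n t = <⇒≢ 1≤n (≡ᵇ⇒≡ 0 _ (proj₁ (split∧ t)))
no-empty-A r m n (b ∷ β) _   t =
  let (pβ , t₁) = split∧ {isPartition (b ∷ β)} t
      (_ , t₂)  = split∧ {size (b ∷ β) ≡ᵇ n} t₁
      (b≤0 , _) = split∧ {b ≤ᵇ 0} t₂
  in <⇒≱ (All.head (proj₂ (isPartition⇒ (b ∷ β) pβ))) (≤ᵇ⇒≤ b 0 b≤0)

no-empty-B : ∀ r m n β → ¬ InB r m n ([] , β)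
no-empty-B r m n β t = proj₂ (split∧ t)

transform : (Word → Word) → Pair → Pair
transform t ([]     , β) = [] , β
transform t (a ∷ xs , β) = a ∷ ups (t (merge xs β)) , downs (t (merge xs β))

transform-inverse : ∀ s t a xs β → Valid (t (merge xs β)) → s (t (merge xs β)) ≡ merge xs β →
                    transform s (transform t (a ∷ xs , β)) ≡ (a ∷ xs , β)
transform-inverse s t a xs β valid inverse
  rewrite merge-ups-downs (t (merge xs β)) valid | inverse | ups-merge xs β | downs-merge xs β = refl

raise-pairs : ∀ r m n → 1 ≤ n → ∀ p → InA r m n p → InB r m n (transform (raise 0) p)
raise-pairs r m n 1≤n ([]     , β) t = ⊥-elim (no-empty-A r m n β 1≤n t)
raise-pairs r m n 1≤n (a ∷ xs , β) t = wordB⇒pairB {r} {m} _ (raise-AB _ (pairA⇒wordA {r} {m} {n} a xs β t))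

lower-pairs : ∀ r m n p → InB r m n p → InA r m n (transform (lower r 0) p)
lower-pairs r m n ([]     , β) t = ⊥-elim (no-empty-B r m n β t)
lower-pairs r m n (a ∷ xs , β) t = wordA⇒pairA {r} {m} _ (proj₁ (lower-BA _ (pairB⇒wordB {r} {m} {n} a xs β t)))

lower-raise-pairs : ∀ r m n p → InA r m n p → transform (lower r 0) (transform (raise 0) p) ≡ p
lower-raise-pairs r m n ([]     , β) _ = refl
lower-raise-pairs r m n (a ∷ xs , β) t =
  transform-inverse (lower r 0) (raise 0) a xs β (raise-valid 0 _ (Encodes.valid encodes)) (lower-raise-A _ wa)
  where
  wa = pairA⇒wordA {r} {m} {n} a xs β t
  open WordA wa

raise-lower-pairs : ∀ r m n p → InB r m n p → transform (raise 0) (transform (lower r 0) p) ≡ p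
raise-lower-pairs r m n ([]     , β) _ = refl
raise-lower-pairs r m n (a ∷ xs , β) t =
  transform-inverse (raise 0) (lower r 0) a xs β (lower-valid r 0 _ (Encodes.valid encodes)) (proj₂ (lower-BA _ wb))
  where
  wb = pairB⇒wordB {r} {m} {n} a xs β t
  open WordB wb

restrict-⤖ : ∀ {X : Set} {P Q : X → Set} → (∀ x → Irrelevant (P x)) → (∀ x → Irrelevant (Q x)) →
             (f g : X → X) → (∀ x → P x → Q (f x)) → (∀ x → Q x → P (g x)) →
             (∀ x → P x → g (f x) ≡ x) → (∀ x → Q x → f (g x) ≡ x) → Σ X P ⤖ Σ X Q
restrict-⤖ {X} {P} {Q} P-irr Q-irr f g f-pres g-pres gf fg =
  ↔⇒⤖ (mk↔ₛ′ (λ (x , p) → f x , f-pres x p) (λ (y , q) → g y , g-pres y q)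
             (λ (y , q) → Σ-≡ Q-irr (fg y q)) (λ (x , p) → Σ-≡ P-irr (gf x p)))
  where
  Σ-≡ : ∀ {R : X → Set} → (∀ x → Irrelevant (R x)) → ∀ {x y} {p : R x} {q : R y} → x ≡ y →
        _≡_ {A = Σ X R} (x , p) (y , q)
  Σ-≡ R-irr {x} {p = p} {q} refl = cong (x ,_) (R-irr x p q)

theorem2p4 : (r m n : ℕ) → 1 ≤ n → PairsA r m n ⤖ PairsB r m n
theorem2p4 r m n 1≤n =
  restrict-⤖ {P = InA r m n} {Q = InB r m n} (λ _ → T-irrelevant) (λ _ → T-irrelevant)
    (transform (raise 0)) (transform (lower r 0))
    (raise-pairs r m n 1≤n) (lower-pairs r m n) (lower-raise-pairs r m n) (raise-lower-pairs r m n)
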